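{- Let $P=(X,\leq_P)$ and $Q$ be connected finite posets with at least two points and let $f:P\to Q$ be an order homomorphism. Then there exists an order homomorphism $g:P\to Q$ with $g|_{M(P)}=f|_{M(P)}$, $f[L(P)]\cap L(Q)\subseteq g[L(P)]\subseteq L(Q)$, and $f[U(P)]\cap U(Q)\subseteq g[U(P)]\subseteq U(Q)$. In particular, if $f$ is a retraction of $P$ onto $Q$ (so $Q$ is an induced subposet of $P$ and $f|_Q=\mathrm{id}_Q$), then there exists a retraction $g$ of $P$ onto $Q$ satisfying these three properties.
   Context: $L(P)$, $U(P)$: minimal and maximal points of $P$; $E(P)=L(P)\cup U(P)$, $M(P)=X\setminus E(P)$. A retraction is an idempotent order homomorphism $r:P\to P$, identified with its corestriction onto its image $Q$. -}

module Defs where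

open import Level using (0ℓ)
open import Data.Nat using (ℕ; _≤_)
open import Data.Fin using (Fin)
open import Data.Product using (Σ; _×_; ∃; _,_)
open import Data.Sum using (_⊎_)
open import Relation.Nullary using (¬_)
open import Relation.Binary.Core using (Rel)
open import Relation.Binary.Definitions using (Decidable)
open import Relation.Binary.Structures using (IsPartialOrder)
open import Relation.Binary.PropositionalEquality using (_≡_)
open import Relation.Binary.Construct.Closure.ReflexiveTransitive using (Star)

record FinPoset : Set₁ where
  field
    size  : ℕ
    _≼_   : Rel (Fin size) 0ℓ
    isPO  : IsPartialOrder _≡_ _≼_
    _≼?_  : Decidable _≼_

  Pt : Set
  Pt = Fin size

  Comparable : Rel Pt 0ℓ
  Comparable x y = (x ≼ y) ⊎ (y ≼ x)

open FinPoset public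

Connected : FinPoset → Set
Connected P = ∀ (x y : Pt P) → Star (Comparable P) x y

AtLeastTwo : FinPoset → Set
AtLeastTwo P = 2 ≤ size P

Monotone : (P Q : FinPoset) → (Pt P → Pt Q) → Set
Monotone P Q f = ∀ {x y} → _≼_ P x y → _≼_ Q (f x) (f y)

-- x ∈ L(P): minimal point
Minimal : (P : FinPoset) → Pt P → Set
Minimal P x = ∀ y → _≼_ P y x → y ≡ x

-- x ∈ U(P): maximal point
Maximal : (P : FinPoset) → Pt P → Set
Maximal P x = ∀ y → _≼_ P x y → y ≡ x

-- x ∈ M(P) = X \ (L(P) ∪ U(P))
Middle : (P : FinPoset) → Pt P → Set
Middle P x = ¬ Minimal P x × ¬ Maximal P x

-- order embedding (makes the image an induced subposet)
OrderEmbedding : (Q P : FinPoset) → (Pt Q → Pt P) → Set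
OrderEmbedding Q P e = ∀ x y → (_≼_ Q x y → _≼_ P (e x) (e y)) × (_≼_ P (e x) (e y) → _≼_ Q x y)

GoodFor : (P Q : FinPoset) → (f g : Pt P → Pt Q) → Set
GoodFor P Q f g =
    (∀ x → Middle P x → g x ≡ f x)
  × ((∀ x → Minimal P x → Minimal Q (f x) → Σ (Pt P) λ x' → Minimal P x' × g x' ≡ f x)
     × (∀ x → Minimal P x → Minimal Q (g x)))
  × ((∀ x → Maximal P x → Maximal Q (f x) → Σ (Pt P) λ x' → Maximal P x' × g x' ≡ f x)
     × (∀ x → Maximal P x → Maximal Q (g x)))

{-# OPTIONS --safe #-}
-- Replace f by g, which sends every minimal point of P to a minimal point of Q
-- below its f-value, every maximal point to a maximal point above it, and agrees
-- with f elsewhere.  A strict comparability x < y in P has x non-maximal and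
-- y non-minimal, so g x ≼ f x ≼ f y ≼ g y and g stays monotone.  Connectedness
-- and two points guarantee that no point is both minimal and maximal, so the
-- cases do not clash; and where f already hits an extremal point of Q, that
-- point is the only candidate, so g keeps it.
module Submission where

open import Defs
open import Function using (flip; const; _∘_)
open import Data.Nat using (_<_; s≤s; z≤n)
open import Data.Nat.Properties using (≤-trans)
open import Data.Fin using (fromℕ<)
open import Data.Fin.Properties using (_≟_; any?; all?; fromℕ<-injective)
open import Data.Fin.Induction using (po-wellFounded)
open import Data.Product using (Σ; _×_; _,_; proj₁; proj₂)
open import Data.Sum using (inj₁; inj₂)
open import Data.Empty using (⊥-elim)
open import Relation.Nullary using (¬_; Dec; yes; no)
open import Relation.Nullary.Decidable using (_×-dec_; _→-dec_; ¬?)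
open import Relation.Binary.Structures using (IsPartialOrder)
open import Relation.Binary.PropositionalEquality using (_≡_; refl; sym; trans; cong; subst; module ≡-Reasoning)
open import Relation.Binary.Construct.Closure.ReflexiveTransitive using (Star; ε; _◅_)
import Relation.Binary.Construct.Flip.EqAndOrd as Flip
import Relation.Binary.Construct.NonStrictToStrict as ToStrict
open import Induction.WellFounded using (Acc; acc)

dual : FinPoset → FinPoset
dual R = record
  { size = size R
  ; _≼_  = flip (_≼_ R)
  ; isPO = Flip.isPartialOrder (isPO R)
  ; _≼?_ = flip (_≼?_ R)
  }

module _ (R : FinPoset) where
  private
    module R = IsPartialOrder (isPO R)

  minimal? : ∀ x → Dec (Minimal R x)
  minimal? x = all? λ y → _≼?_ R y x →-dec (y ≟ x)

  minimal-below : ∀ x → Σ (Pt R) λ m → Minimal R m × _≼_ R m x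
  minimal-below x = descend x (po-wellFounded (isPO R) x)
    where
    descend : ∀ x → Acc (ToStrict._<_ _≡_ (_≼_ R)) x → Σ (Pt R) λ m → Minimal R m × _≼_ R m x
    descend x (acc rec) with any? (λ y → _≼?_ R y x ×-dec ¬? (y ≟ x))
    ... | yes (y , y<x) with descend y (rec y<x)
    ...   | m , min , m≼y = m , min , R.trans m≼y (proj₁ y<x)
    descend x (acc rec) | no ∄y<x = x , minimal , R.refl
      where
      minimal : Minimal R x
      minimal y y≼x with y ≟ x
      ... | yes y≡x = y≡x
      ... | no  y≢x = ⊥-elim (∄y<x (y , y≼x , y≢x))

  minimal∧maximal⇒isolated : ∀ {x y} → Minimal R x → Maximal R x → Star (Comparable R) x y → y ≡ x
  minimal∧maximal⇒isolated min max ε = refl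
  minimal∧maximal⇒isolated min max (inj₁ x≼z ◅ path) with max _ x≼z
  ... | refl = minimal∧maximal⇒isolated min max path
  minimal∧maximal⇒isolated min max (inj₂ z≼x ◅ path) with min _ z≼x
  ... | refl = minimal∧maximal⇒isolated min max path

  connected⇒¬minimal∧maximal : Connected R → AtLeastTwo R → ∀ {x} → Minimal R x → ¬ Maximal R x
  connected⇒¬minimal∧maximal connected two {x} min max = 0≢1 (fromℕ<-injective 0 1 0<n two first≡second)
    where
    0≢1 : ¬ 0 ≡ 1
    0≢1 ()
    0<n : 0 < size R
    0<n = ≤-trans (s≤s z≤n) two
    first≡second : fromℕ< 0<n ≡ fromℕ< two
    first≡second = begin
      fromℕ< 0<n ≡⟨ minimal∧maximal⇒isolated min max (connected x _) ⟩
      x          ≡⟨ sym (minimal∧maximal⇒isolated min max (connected x _)) ⟩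
      fromℕ< two ∎
      where open ≡-Reasoning

maximal? : (R : FinPoset) → ∀ x → Dec (Maximal R x)
maximal? R = minimal? (dual R)

maximal-above : (R : FinPoset) → ∀ x → Σ (Pt R) λ m → Maximal R m × _≼_ R x m
maximal-above R = minimal-below (dual R)

retraction-reflects-minimal : (P Q : FinPoset) (e : Pt Q → Pt P) (r : Pt P → Pt Q)
  → Monotone Q P e → (∀ q → r (e q) ≡ q) → ∀ q → Minimal P (e q) → Minimal Q q
retraction-reflects-minimal P Q e r e-mono r∘e≡id q min y y≼q = begin
  y         ≡⟨ sym (r∘e≡id y) ⟩
  r (e y)   ≡⟨ cong r (min (e y) (e-mono y≼q)) ⟩
  r (e q)   ≡⟨ r∘e≡id q ⟩
  q         ∎
  where open ≡-Reasoning

retraction-reflects-maximal : (P Q : FinPoset) (e : Pt Q → Pt P) (r : Pt P → Pt Q)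
  → Monotone Q P e → (∀ q → r (e q) ≡ q) → ∀ q → Maximal P (e q) → Maximal Q q
retraction-reflects-maximal P Q e r e-mono =
  retraction-reflects-minimal (dual P) (dual Q) e r e-mono

module _ (P Q : FinPoset) (f g : Pt P → Pt Q) where
  private
    module Q = IsPartialOrder (isPO Q)

  monotone-lowered-raised : Monotone P Q f
    → (∀ x → ¬ Maximal P x → _≼_ Q (g x) (f x))
    → (∀ x → ¬ Minimal P x → _≼_ Q (f x) (g x))
    → Monotone P Q g
  monotone-lowered-raised f-mono lowered raised {x} {y} x≼y with x ≟ y
  ... | yes refl = Q.refl
  ... | no x≢y   = Q.trans (lowered x λ max → x≢y (sym (max y x≼y)))
                  (Q.trans (f-mono x≼y) (raised y λ min → x≢y (min x x≼y)))

module Extremalise (P Q : FinPoset) (f : Pt P → Pt Q) where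
  private
    module Q = IsPartialOrder (isPO Q)

  extremalise : Pt P → Pt Q
  extremalise x with minimal? P x | maximal? P x
  ... | yes _ | _     = proj₁ (minimal-below Q (f x))
  ... | no _  | yes _ = proj₁ (maximal-above Q (f x))
  ... | no _  | no _  = f x

  extremalise-≼ : ∀ x → ¬ Maximal P x → _≼_ Q (extremalise x) (f x)
  extremalise-≼ x ¬max with minimal? P x | maximal? P x
  ... | yes _ | _       = proj₂ (proj₂ (minimal-below Q (f x)))
  ... | no _  | yes max = ⊥-elim (¬max max)
  ... | no _  | no _    = Q.refl

  extremalise-≽ : ∀ x → ¬ Minimal P x → _≼_ Q (f x) (extremalise x)
  extremalise-≽ x ¬min with minimal? P x | maximal? P x
  ... | yes min | _     = ⊥-elim (¬min min)
  ... | no _    | yes _ = proj₂ (proj₂ (maximal-above Q (f x)))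
  ... | no _    | no _  = Q.refl

  extremalise-minimal : ∀ x → Minimal P x → Minimal Q (extremalise x)
  extremalise-minimal x min with minimal? P x
  ... | yes _   = proj₁ (proj₂ (minimal-below Q (f x)))
  ... | no ¬min = ⊥-elim (¬min min)

  extremalise-maximal : ∀ x → ¬ Minimal P x → Maximal P x → Maximal Q (extremalise x)
  extremalise-maximal x ¬min max with minimal? P x | maximal? P x
  ... | yes min | _       = ⊥-elim (¬min min)
  ... | no _    | yes _   = proj₁ (proj₂ (maximal-above Q (f x)))
  ... | no _    | no ¬max = ⊥-elim (¬max max)

  extremalise-middle : ∀ x → Middle P x → extremalise x ≡ f x
  extremalise-middle x (¬min , ¬max) with minimal? P x | maximal? P x
  ... | yes min | _       = ⊥-elim (¬min min)
  ... | no _    | yes max = ⊥-elim (¬max max)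
  ... | no _    | no _    = refl

  module _ (¬minimal∧maximal : ∀ {x} → Minimal P x → ¬ Maximal P x) where

    extremalise-fixes : ∀ x → (Minimal P x → Minimal Q (f x)) → (Maximal P x → Maximal Q (f x))
      → extremalise x ≡ f x
    extremalise-fixes x min-pres max-pres = by-cases (minimal? P x) (maximal? P x)
      where
      by-cases : Dec (Minimal P x) → Dec (Maximal P x) → extremalise x ≡ f x
      by-cases (yes min) _         = min-pres min (extremalise x) (extremalise-≼ x (¬minimal∧maximal min))
      by-cases (no ¬min) (yes max) = max-pres max (extremalise x) (extremalise-≽ x ¬min)
      by-cases (no ¬min) (no ¬max) = extremalise-middle x (¬min , ¬max)

    extremalise-monotone : Monotone P Q f → Monotone P Q extremalise
    extremalise-monotone f-mono = monotone-lowered-raised P Q f extremalise f-mono extremalise-≼ extremalise-≽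

    extremalise-good : GoodFor P Q f extremalise
    extremalise-good =
        extremalise-middle
      , ( (λ x min min-fx → x , min , extremalise-fixes x (const min-fx) (⊥-elim ∘ ¬minimal∧maximal min))
        , extremalise-minimal )
      , ( (λ x max max-fx → x , max , extremalise-fixes x (λ min → ⊥-elim (¬minimal∧maximal min max)) (const max-fx))
        , λ x max → extremalise-maximal x (λ min → ¬minimal∧maximal min max) max )

lemma1 : (P Q : FinPoset) → Connected P → Connected Q → AtLeastTwo P → AtLeastTwo Q
    → (f : Pt P → Pt Q) → Monotone P Q f
    → (Σ (Pt P → Pt Q) λ g → Monotone P Q g × GoodFor P Q f g)
    × ((e : Pt Q → Pt P) → OrderEmbedding Q P e → (∀ q → f (e q) ≡ q)
    → Σ (Pt P → Pt Q) λ g → Monotone P Q g × (∀ q → g (e q) ≡ q) × GoodFor P Q f g)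
lemma1 P Q conP _ twoP _ f f-mono =
    (extremalise , monotone , good)
  , λ e emb f∘e≡id → extremalise , monotone , fixes-image e emb f∘e≡id , good
  where
  open Extremalise P Q f
  ¬minimal∧maximal : ∀ {x} → Minimal P x → ¬ Maximal P x
  ¬minimal∧maximal = connected⇒¬minimal∧maximal P conP twoP

  monotone : Monotone P Q extremalise
  monotone = extremalise-monotone ¬minimal∧maximal f-mono

  good : GoodFor P Q f extremalise
  good = extremalise-good ¬minimal∧maximal

  fixes-image : (e : Pt Q → Pt P) → OrderEmbedding Q P e → (∀ q → f (e q) ≡ q) → ∀ q → extremalise (e q) ≡ q
  fixes-image e emb f∘e≡id q = trans
    (extremalise-fixes ¬minimal∧maximal (e q)
      (λ min → subst (Minimal Q) (sym (f∘e≡id q)) (retraction-reflects-minimal P Q e f e-mono f∘e≡id q min))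
      (λ max → subst (Maximal Q) (sym (f∘e≡id q)) (retraction-reflects-maximal P Q e f e-mono f∘e≡id q max)))
    (f∘e≡id q)
    where
    e-mono : Monotone Q P e
    e-mono {x} {y} = proj₁ (emb x y)
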